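{- For any path $P_n$ of order $n \ge 2$, $\gamma(M(P_n)) = \left\lceil \frac{n}{2}\right\rceil$.
   Context: $P_n$ is the path graph on $n$ vertices. For a finite simple graph $H$, the middle graph $M(H)$ is the graph with vertex set $V(H)\cup E(H)$ in which two elements $x,y$ are adjacent if and only if either (1) $x,y\in E(H)$ and the edges $x,y$ share a common endpoint in $H$, or (2) $x\in V(H)$, $y\in E(H)$ and $x$ is an endpoint of $y$ (or vice versa). A dominating set of a graph $H$ is a set $S\subseteq V(H)$ such that every vertex of $H$ is in $S$ or adjacent to a vertex of $S$; the domination number $\gamma(H)$ is the minimum cardinality of a dominating set of $H$. -}

module Defs where

open import Data.Nat using (ℕ; zero; suc; _≤_)
open import Data.Fin using (Fin; zero; suc; toℕ; inject₁; splitAt)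
open import Data.Fin.Properties using (toℕ-inject₁; toℕ-injective)
open import Data.Fin.Subset using (Subset; _∈_; ∣_∣)
open import Data.Product using (_×_; _,_; proj₁; proj₂; ∃; Σ-syntax)
open import Data.Sum using (_⊎_; inj₁; inj₂)
open import Data.Empty using (⊥; ⊥-elim)
open import Relation.Nullary using (¬_)
open import Relation.Binary.PropositionalEquality using (_≡_; refl; sym; trans; cong)
import Data.Nat.Properties as ℕP

record Graph : Set₁ where
  field
    N   : ℕ
    Adj : Fin N → Fin N → Set

module _ (G : Graph) where
  open Graph G

  Dominating : Subset N → Set
  Dominating S = ∀ v → v ∈ S ⊎ (Σ[ u ∈ Fin N ] (u ∈ S × Adj u v))

  IsDominationNumber : ℕ → Set
  IsDominationNumber k =
    (Σ[ S ∈ Subset N ] (Dominating S × ∣ S ∣ ≡ k))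
    × (∀ (S : Subset N) → Dominating S → k ≤ ∣ S ∣)

record SimpleGraph : Set where
  field
    n    : ℕ
    m    : ℕ
    ends : Fin m → Fin n × Fin n
    loopless : ∀ e → ¬ (proj₁ (ends e) ≡ proj₂ (ends e))
    noMulti  : ∀ e f →
      ((proj₁ (ends e) ≡ proj₁ (ends f)) × (proj₂ (ends e) ≡ proj₂ (ends f)))
      ⊎ ((proj₁ (ends e) ≡ proj₂ (ends f)) × (proj₂ (ends e) ≡ proj₁ (ends f)))
      → e ≡ f

module _ (H : SimpleGraph) where
  open SimpleGraph H

  Incident : Fin n → Fin m → Set
  Incident v e = (v ≡ proj₁ (ends e)) ⊎ (v ≡ proj₂ (ends e))

  ShareEndpoint : Fin m → Fin m → Set
  ShareEndpoint e f = ¬ (e ≡ f) × (Σ[ v ∈ Fin n ] (Incident v e × Incident v f))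

  MAdj : Fin n ⊎ Fin m → Fin n ⊎ Fin m → Set
  MAdj (inj₁ x) (inj₁ y) = ⊥
  MAdj (inj₁ x) (inj₂ f) = Incident x f
  MAdj (inj₂ e) (inj₁ y) = Incident y e
  MAdj (inj₂ e) (inj₂ f) = ShareEndpoint e f

  -- The middle graph M(H), with vertex set V(H) ∪ E(H) encoded as Fin (n + m)
  -- (the first n elements are the vertices, the last m are the edges).
  Middle : Graph
  Middle = record { N = n Data.Nat.+ m
                  ; Adj = λ x y → MAdj (splitAt n x) (splitAt n y) }

-- The path P_{k+1}: vertices 0..k, edges i ∈ Fin k joining i and i+1.

private
  inj≢suc : ∀ {k} (i j : Fin k) → ¬ (inject₁ i ≡ suc j × suc i ≡ inject₁ j)
  inj≢suc i j (p , q) =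
    ℕP.<-irrefl refl (ℕP.<-trans a b)
    where
      a : toℕ j Data.Nat.< toℕ i
      a = ℕP.≤-reflexive (trans (sym (cong toℕ p)) (toℕ-inject₁ i)) 
      b : toℕ i Data.Nat.< toℕ j
      b = ℕP.≤-reflexive (trans (cong toℕ q) (toℕ-inject₁ j))

  loop : ∀ {k} (i : Fin k) → ¬ (inject₁ i ≡ suc i)
  loop i p = ℕP.<-irrefl (trans (sym (toℕ-inject₁ i)) (cong toℕ p)) ℕP.≤-refl

  inj-inj : ∀ {k} (i j : Fin k) → inject₁ i ≡ inject₁ j → i ≡ j
  inj-inj i j p = toℕ-injective
    (trans (sym (toℕ-inject₁ i)) (trans (cong toℕ p) (toℕ-inject₁ j)))

PathSuc : ℕ → SimpleGraph
PathSuc k = record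
  { n = suc k
  ; m = k
  ; ends = λ i → (inject₁ i , suc i)
  ; loopless = loop
  ; noMulti = λ { e f (inj₁ (p , _)) → inj-inj e f p
                ; e f (inj₂ pq) → ⊥-elim (inj≢suc e f pq) }
  }

-- P n : the path on n vertices, for n ≥ 1 (P 0 is the empty graph).
P : ℕ → SimpleGraph
P zero    = record { n = 0 ; m = 0 ; ends = λ () ; loopless = λ () ; noMulti = λ () }
P (suc k) = PathSuc k

-- Write P (k + 1) with vertices v₀ … v_k and edges eᵢ = v_i v_{i+1}, i < k.
--
-- The edges e₀, e₂, e₄, … together with the last vertex v_k
-- when k is even dominate M(P (k + 1)).  Both the set and the proof that it
-- dominates are built by recursion on k in steps of two: deleting v₀, v₁,
-- e₀, e₁ from P (k + 3) leaves a copy of P (k + 1) shifted by two, and the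
-- shift preserves adjacency in the middle graph.  The set has ⌈ (k+1) /2⌉
-- elements.
--
-- The closed neighbourhoods of the even vertices
-- v₀, v₂, …, v_{2j}, … (there are ⌈ n /2⌉ of them) are pairwise disjoint:
-- the label ⌊ i /2⌋ on vᵢ and ⌈ i /2⌉ on eᵢ equals j on the whole closed
-- neighbourhood of v_{2j}.  A dominating set meets each of them, so choosing
-- one dominator per even vertex is an injection into the dominating set.

module Submission where

open import Defs
open import Data.Nat using (ℕ; _≤_; ⌈_/2⌉; zero; suc; _+_; _<_; ⌊_/2⌋; z≤n; s≤s)
import Data.Nat.Properties as NP
open import Data.Fin using (Fin; zero; suc; toℕ; inject₁; splitAt; join; _↑ˡ_; fromℕ<)
open import Data.Fin.Properties
  using (toℕ-inject₁; toℕ-injective; toℕ-fromℕ<; toℕ<n; splitAt-↑ˡ; splitAt-join; join-splitAt; injective⇒≤)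
  renaming (suc-injective to Fin-suc-injective)
open import Data.Fin.Subset using (Subset; _∈_; ∣_∣; inside; outside)
open import Data.Vec using ([]; _∷_; _++_; here; there)
open import Data.Product using (_×_; _,_; proj₁; proj₂; Σ-syntax)
open import Data.Sum using (_⊎_; inj₁; inj₂)
import Data.Sum as Sum
open import Relation.Binary.PropositionalEquality

rank : ∀ {N} (p : Subset N) {x : Fin N} → x ∈ p → Fin ∣ p ∣
rank (inside ∷ p)  here      = zero
rank (inside ∷ p)  (there q) = suc (rank p q)
rank (outside ∷ p) (there q) = rank p q

rank-injective : ∀ {N} (p : Subset N) {x y : Fin N} (q : x ∈ p) (r : y ∈ p) →
                 rank p q ≡ rank p r → x ≡ y
rank-injective (inside ∷ p)  here      here      _  = refl
rank-injective (inside ∷ p)  (there q) (there r) eq =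
  cong suc (rank-injective p q r (Fin-suc-injective eq))
rank-injective (outside ∷ p) (there q) (there r) eq = cong suc (rank-injective p q r eq)

injection-into-subset : ∀ {N c} (S : Subset N) (f : Fin c → Fin N) →
                        (∀ i → f i ∈ S) → (∀ {i j} → f i ≡ f j → i ≡ j) → c ≤ ∣ S ∣
injection-into-subset S f f∈S f-inj =
  injective⇒≤ (λ eq → f-inj (rank-injective S (f∈S _) (f∈S _) eq))

∣++∣ : ∀ {a b} (p : Subset a) (q : Subset b) → ∣ p ++ q ∣ ≡ ∣ p ∣ + ∣ q ∣
∣++∣ []            q = refl
∣++∣ (inside ∷ p)  q = cong suc (∣++∣ p q)
∣++∣ (outside ∷ p) q = ∣++∣ p q

Member : ∀ {a b} → Subset a → Subset b → Fin a ⊎ Fin b → Set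
Member p q (inj₁ x) = x ∈ p
Member p q (inj₂ y) = y ∈ q

∈-++ : ∀ {a b} (p : Subset a) (q : Subset b) (s : Fin a ⊎ Fin b) →
       Member p q s → join a b s ∈ p ++ q
∈-++ (_ ∷ p) q (inj₁ zero)    here      = here
∈-++ (_ ∷ p) q (inj₁ (suc x)) (there m) = there (∈-++ p q (inj₁ x) m)
∈-++ []      q (inj₂ y)       m         = m
∈-++ (_ ∷ p) q (inj₂ y)       m         = there (∈-++ p q (inj₂ y) m)

module _ (H : SimpleGraph) where
  open SimpleGraph H

  DominatedBy : Subset n → Subset m → Fin n ⊎ Fin m → Set
  DominatedBy p q s = Member p q s ⊎ (Σ[ t ∈ Fin n ⊎ Fin m ] (Member p q t × MAdj H t s))

  middle-dominating : (p : Subset n) (q : Subset m) →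
                      (∀ s → DominatedBy p q s) → Dominating (Middle H) (p ++ q)
  middle-dominating p q dom x =
    subst Dominated (join-splitAt n m x) (lift (splitAt n x) (dom (splitAt n x)))
    where
      Dominated : Fin (n + m) → Set
      Dominated y = y ∈ p ++ q ⊎ (Σ[ u ∈ Fin (n + m) ] (u ∈ p ++ q × Graph.Adj (Middle H) u y))

      lift : ∀ s → DominatedBy p q s → Dominated (join n m s)
      lift s (inj₁ s∈) = inj₁ (∈-++ p q s s∈)
      lift s (inj₂ (t , t∈ , adj)) =
        inj₂ (join n m t , ∈-++ p q t t∈ ,
              subst₂ (MAdj H) (sym (splitAt-join n m t)) (sym (splitAt-join n m s)) adj)

  closed-neighbour : (T : Subset (n + m)) → Dominating (Middle H) T → (v : Fin n) →
                     Σ[ u ∈ Fin (n + m) ]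
                       (u ∈ T × (splitAt n u ≡ inj₁ v ⊎ MAdj H (splitAt n u) (inj₁ v)))
  closed-neighbour T dom v with dom (v ↑ˡ m)
  ... | inj₁ v∈T = v ↑ˡ m , v∈T , inj₁ (splitAt-↑ˡ n v m)
  ... | inj₂ (u , u∈T , adj) = u , u∈T , inj₂ (subst (MAdj H (splitAt n u)) (splitAt-↑ˡ n v m) adj)

lastIfEven : (k : ℕ) → Subset (suc k)
lastIfEven zero          = inside ∷ []
lastIfEven (suc zero)    = outside ∷ outside ∷ []
lastIfEven (suc (suc k)) = outside ∷ outside ∷ lastIfEven k

evenEdges : (k : ℕ) → Subset k
evenEdges zero          = []
evenEdges (suc zero)    = inside ∷ []
evenEdges (suc (suc k)) = inside ∷ outside ∷ evenEdges k

size : ∀ k → ∣ lastIfEven k ∣ + ∣ evenEdges k ∣ ≡ ⌈ suc k /2⌉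
size zero          = refl
size (suc zero)    = refl
size (suc (suc k)) = trans (NP.+-suc ∣ lastIfEven k ∣ ∣ evenEdges k ∣) (cong suc (size k))

-- Deleting v₀, v₁, e₀, e₁ from P (k + 3) leaves P (k + 1) shifted by two.
shift : ∀ {k} → Fin (suc k) ⊎ Fin k → Fin (suc (suc (suc k))) ⊎ Fin (suc (suc k))
shift = Sum.map (λ v → suc (suc v)) (λ e → suc (suc e))

shift-incident : ∀ {k} {v : Fin (suc k)} {e : Fin k} →
                 Incident (PathSuc k) v e → Incident (PathSuc (suc (suc k))) (suc (suc v)) (suc (suc e))
shift-incident = Sum.map (cong (λ w → suc (suc w))) (cong (λ w → suc (suc w)))

shift-adjacent : ∀ {k} (t s : Fin (suc k) ⊎ Fin k) →
                 MAdj (PathSuc k) t s → MAdj (PathSuc (suc (suc k))) (shift t) (shift s)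
shift-adjacent (inj₁ v) (inj₂ f) inc = shift-incident inc
shift-adjacent (inj₂ e) (inj₁ w) inc = shift-incident inc
shift-adjacent (inj₂ e) (inj₂ f) (e≢f , w , w∈e , w∈f) =
  (λ eq → e≢f (Fin-suc-injective (Fin-suc-injective eq))) ,
  suc (suc w) , shift-incident w∈e , shift-incident w∈f

shift-member : ∀ {k} (t : Fin (suc k) ⊎ Fin k) → Member (lastIfEven k) (evenEdges k) t →
               Member (lastIfEven (suc (suc k))) (evenEdges (suc (suc k))) (shift t)
shift-member (inj₁ _) t∈ = there (there t∈)
shift-member (inj₂ _) t∈ = there (there t∈)

shift-dominated : ∀ {k} (s : Fin (suc k) ⊎ Fin k) →
                  DominatedBy (PathSuc k) (lastIfEven k) (evenEdges k) s →
                  DominatedBy (PathSuc (suc (suc k)))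
                    (lastIfEven (suc (suc k))) (evenEdges (suc (suc k))) (shift s)
shift-dominated s (inj₁ s∈) = inj₁ (shift-member s s∈)
shift-dominated s (inj₂ (t , t∈ , adj)) = inj₂ (shift t , shift-member t t∈ , shift-adjacent t s adj)

-- Every vertex and every edge of P (k + 1) is dominated by the chosen set:
-- v₀, v₁, e₀, e₁ directly by e₀, everything else by the shifted set for P (k - 1).
dominated : ∀ k (s : Fin (suc k) ⊎ Fin k) → DominatedBy (PathSuc k) (lastIfEven k) (evenEdges k) s
dominated zero          (inj₁ zero)          = inj₁ here
dominated (suc zero)    (inj₁ zero)          = inj₂ (inj₂ zero , here , inj₁ refl)
dominated (suc zero)    (inj₁ (suc zero))    = inj₂ (inj₂ zero , here , inj₂ refl)
dominated (suc zero)    (inj₂ zero)          = inj₁ here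
dominated (suc (suc k)) (inj₁ zero)          = inj₂ (inj₂ zero , here , inj₁ refl)
dominated (suc (suc k)) (inj₁ (suc zero))    = inj₂ (inj₂ zero , here , inj₂ refl)
dominated (suc (suc k)) (inj₂ zero)          = inj₁ here
dominated (suc (suc k)) (inj₂ (suc zero))    =
  inj₂ (inj₂ zero , here , (λ ()) , suc zero , inj₂ refl , inj₁ refl)
dominated (suc (suc k)) (inj₁ (suc (suc v))) = shift-dominated (inj₁ v) (dominated k (inj₁ v))
dominated (suc (suc k)) (inj₂ (suc (suc e))) = shift-dominated (inj₂ e) (dominated k (inj₂ e))

double<n : ∀ n j → j < ⌈ n /2⌉ → j + j < n
double<n (suc zero)    zero    _ = s≤s z≤n
double<n (suc zero)    (suc j) (s≤s ())
double<n (suc (suc n)) zero    _ = s≤s z≤n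
double<n (suc (suc n)) (suc j) (s≤s j<) =
  s≤s (subst (_< suc n) (sym (NP.+-suc j j)) (s≤s (double<n n j j<)))

-- The label ⌊ i /2⌋ on vᵢ and ⌈ i /2⌉ on eᵢ; it separates the closed
-- neighbourhoods of distinct even vertices.
label : ∀ {k} → Fin (suc k) ⊎ Fin k → ℕ
label (inj₁ v) = ⌊ toℕ v /2⌋
label (inj₂ e) = ⌈ toℕ e /2⌉

label-closed-neighbourhood :
  ∀ {k} (v : Fin (suc k)) j → toℕ v ≡ j + j → (s : Fin (suc k) ⊎ Fin k) →
  s ≡ inj₁ v ⊎ MAdj (PathSuc k) s (inj₁ v) → label s ≡ j
label-closed-neighbourhood v j v≡2j (inj₁ v) (inj₁ refl) = begin
  ⌊ toℕ v /2⌋   ≡⟨ cong ⌊_/2⌋ v≡2j ⟩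
  ⌊ j + j /2⌋   ≡⟨ NP.n≡⌊n+n/2⌋ j ⟨
  j             ∎
  where open ≡-Reasoning
label-closed-neighbourhood v j v≡2j (inj₂ e) (inj₂ (inj₁ v≡start)) = begin
  ⌈ toℕ e /2⌉           ≡⟨ cong ⌈_/2⌉ (toℕ-inject₁ e) ⟨
  ⌈ toℕ (inject₁ e) /2⌉ ≡⟨ cong (λ w → ⌈ toℕ w /2⌉) v≡start ⟨
  ⌈ toℕ v /2⌉           ≡⟨ cong ⌈_/2⌉ v≡2j ⟩
  ⌈ j + j /2⌉           ≡⟨ NP.n≡⌈n+n/2⌉ j ⟨
  j                     ∎
  where open ≡-Reasoning
label-closed-neighbourhood v j v≡2j (inj₂ e) (inj₂ (inj₂ v≡end)) = begin
  ⌊ toℕ (suc e) /2⌋ ≡⟨ cong (λ w → ⌊ toℕ w /2⌋) v≡end ⟨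
  ⌊ toℕ v /2⌋       ≡⟨ label-closed-neighbourhood v j v≡2j (inj₁ v) (inj₁ refl) ⟩
  j                 ∎
  where open ≡-Reasoning

lower-bound : ∀ k (T : Subset (suc k + k)) → Dominating (Middle (PathSuc k)) T → ⌈ suc k /2⌉ ≤ ∣ T ∣
lower-bound k T dom = injection-into-subset T dominator (λ j → proj₁ (proj₂ (neighbour j))) distinct
  where
    evenVertex : Fin ⌈ suc k /2⌉ → Fin (suc k)
    evenVertex j = fromℕ< (double<n (suc k) (toℕ j) (toℕ<n j))

    neighbour : ∀ j → Σ[ u ∈ Fin (suc k + k) ]
                  (u ∈ T × (splitAt (suc k) u ≡ inj₁ (evenVertex j)
                            ⊎ MAdj (PathSuc k) (splitAt (suc k) u) (inj₁ (evenVertex j))))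
    neighbour j = closed-neighbour (PathSuc k) T dom (evenVertex j)

    dominator : Fin ⌈ suc k /2⌉ → Fin (suc k + k)
    dominator j = proj₁ (neighbour j)

    labelled : ∀ j → label (splitAt (suc k) (dominator j)) ≡ toℕ j
    labelled j = label-closed-neighbourhood (evenVertex j) (toℕ j) (toℕ-fromℕ< _) _
                   (proj₂ (proj₂ (neighbour j)))

    distinct : ∀ {i j} → dominator i ≡ dominator j → i ≡ j
    distinct {i} {j} eq =
      toℕ-injective (trans (sym (labelled i))
                      (trans (cong (λ u → label (splitAt (suc k) u)) eq) (labelled j)))

-- The two bounds together; the hypothesis 2 ≤ n is only used to exclude n = 0.
proposition3p7 : ∀ (n : ℕ) → 2 ≤ n → IsDominationNumber (Middle (P n)) ⌈ n /2⌉
proposition3p7 zero    ()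
proposition3p7 (suc k) _ =
  ( lastIfEven k ++ evenEdges k
  , middle-dominating (PathSuc k) (lastIfEven k) (evenEdges k) (dominated k)
  , trans (∣++∣ (lastIfEven k) (evenEdges k)) (size k) )
  , lower-bound k
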